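{- Let $\mathscr{M}$ be a linear minion, let $k\in\mathbb{N}$, let $\mathbf{X},\mathbf{A},\mathbf{B}$ be digraphs such that $\mathbf{A}\to\mathbf{B}$, and suppose that there exists a $k$-tensorial homomorphism $\mathbf{X}^{\otimes k}\to\mathbb{F}_{\mathscr{M}}(\mathbf{A}^{\otimes k})$. Then there exists a $k$-tensorial homomorphism $\mathbf{X}^{\otimes k}\to\mathbb{F}_{\mathscr{M}}(\mathbf{B}^{\otimes k})$.
   Context: A digraph $\mathbf{X}$ has vertex set $V(\mathbf{X})$ and edge set $E(\mathbf{X})\subseteq V(\mathbf{X})^2$; $\mathbf{A}\to\mathbf{B}$ means there is a homomorphism (edge-preserving map $V(\mathbf{A})\to V(\mathbf{B})$). For $\pi:[\ell]\to[m]$, $P_\pi$ is the $m\times\ell$ matrix whose $(i,j)$-entry is $1$ if $\pi(j)=i$ and $0$ otherwise. A linear minion $\mathscr{M}$ of depth $d$ is a union of sets $\mathscr{M}^{(\ell)}$ ($\ell\in\mathbb{N}$) of $\ell\times d$ rational matrices such that $P_\pi M\in\mathscr{M}^{(m)}$ whenever $M\in\mathscr{M}^{(\ell)}$ and $\pi:[\ell]\to[m]$. For a $p$-uniform hypergraph $\mathbf{H}$ with $n$ vertices and $m$ hyperedges, the free structure $\mathbb{F}_{\mathscr{M}}(\mathbf{H})$ is the $p$-uniform hypergraph with vertex set $\mathscr{M}^{(n)}$ in which $(M_1,\dots,M_p)$ is a hyperedge iff there is $Q\in\mathscr{M}^{(m)}$ with $M_i=P_{\pi_i}Q$ for all $i$,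 where $\pi_i:E(\mathbf{H})\to V(\mathbf{H})$ sends a hyperedge to its $i$-th entry. The $k$-th tensor power $\mathbf{A}^{\otimes k}$ of a digraph $\mathbf{A}$ is the $2^k$-uniform hypergraph with vertex set $V(\mathbf{A})^k$ and hyperedges $\vec{a}^{\otimes k}$ for $\vec{a}\in E(\mathbf{A})$, where $\vec{a}^{\otimes k}$ is the $2\times\cdots\times 2$ ($k$ modes) array whose $\vec{i}$-th entry is $\vec{a}_{\vec{i}}=(a_{i_1},\dots,a_{i_k})$ for $\vec{i}\in[2]^k$. Identifying $V(\mathbf{A})$ with $[n]$, vertices of $\mathbb{F}_{\mathscr{M}}(\mathbf{A}^{\otimes k})$ are viewed as arrays indexed by $[n]^k\times[d]$. A homomorphism $\xi:\mathbf{X}^{\otimes k}\to\mathbb{F}_{\mathscr{M}}(\mathbf{A}^{\otimes k})$ is $k$-tensorial if for all $\vec{x}\in V(\mathbf{X})^k$ and $\vec{i}\in[k]^k$, $\xi(\vec{x}_{\vec{i}})$ equals the projection of $\xi(\vec{x})$ onto $\vec{i}$, i.e. for each $\vec{a}\in[n]^k$ the $\vec{a}$-th row of $\xi(\vec{x}_{\vec{i}})$ equals $\sum_{\vec{b}\in[n]^k,\ \vec{b}_{\vec{i}}=\vec{a}}$ (the $\vec{b}$-th row of $\xi(\vec{x})$); the same definition applies with $\mathbf{B}$ in place of $\mathbf{A}$. -}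

module Defs where

open import Data.Nat using (ℕ; zero; suc; _^_)
open import Data.Fin using (Fin; zero; suc; _≟_; funToFin; finToFun)
open import Data.Rational using (ℚ; 0ℚ; _+_)
open import Data.Product using (Σ; ∃; _×_; _,_; proj₁; proj₂)
open import Relation.Binary.PropositionalEquality using (_≡_)
open import Relation.Nullary.Decidable using (does)
open import Data.Bool using (if_then_else_)
open import Function using (_∘_)
open import Function.Definitions using (Injective)

-- Finite digraphs: vertex set Fin n, edge set E ⊆ V² given as an
-- injective enumeration Fin m → Fin n × Fin n (so E is a set).

record Digraph : Set where
  field
    n        : ℕ
    m        : ℕ
    edge     : Fin m → Fin n × Fin n
    edge-inj : Injective _≡_ _≡_ edge
open Digraph public

_⟶_ : Digraph → Digraph → Set
A ⟶ B = Σ (Fin (n A) → Fin (n B)) λ f →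
          ∀ (e : Fin (m A)) → ∃ λ (e′ : Fin (m B)) →
            edge B e′ ≡ (f (proj₁ (edge A e)) , f (proj₂ (edge A e)))

Mat : ℕ → ℕ → Set
Mat ℓ d = Fin ℓ → Fin d → ℚ

_≈M_ : ∀ {ℓ d} → Mat ℓ d → Mat ℓ d → Set
M ≈M N = ∀ i c → M i c ≡ N i c

ΣFin : (ℓ : ℕ) → (Fin ℓ → ℚ) → ℚ
ΣFin zero    f = 0ℚ
ΣFin (suc ℓ) f = f zero + ΣFin ℓ (f ∘ suc)

P : ∀ {ℓ m d} → (Fin ℓ → Fin m) → Mat ℓ d → Mat m d
P {ℓ} π M i c = ΣFin ℓ (λ j → if does (π j ≟ i) then M j c else 0ℚ)

record LinearMinion (d : ℕ) : Set₁ where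
  field
    _∈𝓜 : ∀ {ℓ} → Mat ℓ d → Set
    -- membership is a property of the matrix (not of its representation)
    ∈-resp : ∀ {ℓ} {M N : Mat ℓ d} → M ≈M N → M ∈𝓜 → N ∈𝓜
    P-closed : ∀ {ℓ m} (π : Fin ℓ → Fin m) (M : Mat ℓ d) → M ∈𝓜 → P π M ∈𝓜
open LinearMinion public

endpoint : ∀ {n} → Fin 2 → Fin n × Fin n → Fin n
endpoint zero       a = proj₁ a
endpoint (suc zero) a = proj₂ a

Tuple : ℕ → ℕ → Set
Tuple n k = Fin k → Fin n

-- vertices of 𝔽_𝓜(A^{⊗k}) are matrices in 𝓜^(n^k), whose rows are
-- indexed by V(A)^k through the bijection funToFin / finToFun
-- between Fin k → Fin n and Fin (n ^ k).
FVert : ℕ → ℕ → ℕ → Set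
FVert n k d = Mat (n ^ k) d

-- π_i : E(A^{⊗k}) → V(A^{⊗k}), sending the hyperedge a^{⊗k} (a ∈ E(A))
-- to its i-th entry a_i = (a_{i_1}, …, a_{i_k}), for i ∈ [2]^k
πₜ : (A : Digraph) (k : ℕ) → (Fin k → Fin 2) → Fin (m A) → Fin (n A ^ k)
πₜ A k i e = funToFin (λ t → endpoint (i t) (edge A e))

FHyperedge : ∀ {d} (𝓜 : LinearMinion d) (A : Digraph) (k : ℕ) →
             ((Fin k → Fin 2) → FVert (n A) k d) → Set
FHyperedge {d} 𝓜 A k Ms =
  ∃ λ (Q : Mat (m A) d) → (𝓜 ∈𝓜) Q × (∀ i → Ms i ≈M P (πₜ A k i) Q)

IsHom⊗ : ∀ {d} (𝓜 : LinearMinion d) (k : ℕ) (X A : Digraph) →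
         (Tuple (n X) k → FVert (n A) k d) → Set
IsHom⊗ 𝓜 k X A ξ =
  (∀ x → (𝓜 ∈𝓜) (ξ x)) ×
  (∀ (e : Fin (m X)) → FHyperedge 𝓜 A k (λ i → ξ (λ t → endpoint (i t) (edge X e))))

proj : ∀ {n k d} → (Fin k → Fin k) → FVert n k d → FVert n k d
proj {n} {k} i M = P (λ b → funToFin (finToFun {n} {k} b ∘ i)) M

IsTensorial : ∀ {d} (𝓜 : LinearMinion d) (k : ℕ) (X A : Digraph) →
              (Tuple (n X) k → FVert (n A) k d) → Set
IsTensorial 𝓜 k X A ξ =
  IsHom⊗ 𝓜 k X A ξ ×
  (∀ (x : Tuple (n X) k) (i : Fin k → Fin k) → ξ (x ∘ i) ≈M proj i (ξ x))

HasTensorialHom : ∀ {d} (𝓜 : LinearMinion d) (k : ℕ) (X A : Digraph) → Set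
HasTensorialHom {d} 𝓜 k X A =
  ∃ λ (ξ : Tuple (n X) k → FVert (n A) k d) → IsTensorial 𝓜 k X A ξ

{-# OPTIONS --safe #-}
module Submission where

open import Defs
open import Data.Nat using (ℕ; zero; suc; _^_)
open import Data.Fin using (Fin; zero; suc; _≟_; funToFin; finToFun; combine)
open import Data.Fin.Properties using (finToFun-funToFin)
open import Data.Rational using (ℚ; 0ℚ; _+_)
open import Data.Rational.Properties using (+-identityˡ; +-identityʳ; +-0-commutativeMonoid)
open import Algebra.Properties.CommutativeMonoid.Sum +-0-commutativeMonoid
  using (sum; ∑-comm; sum-replicate-zero)
open import Data.Product using (_×_; _,_; proj₁; proj₂)
open import Data.Bool using (Bool; true; false; if_then_else_)
open import Relation.Nullary.Decidable using (does)
open import Relation.Binary.PropositionalEquality using (_≡_; refl; sym; trans; cong; cong₂; module ≡-Reasoning)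
open import Function using (_∘_)

-- Compose the given ξ with P_{f^k}, where f : A → B and f^k acts
-- coordinatewise on V(A)^k. A hyperedge witness Q is sent to P_{f_E} Q,
-- f_E the induced map on edges. Since P_σ P_τ = P_{σ∘τ}, both the
-- hyperedge condition and k-tensoriality follow from commuting squares
-- of index maps: f^k commutes with the entries π_i of hyperedges and
-- with the reindexings b ↦ b ∘ i.

ΣFin-cong : ∀ ℓ {f g : Fin ℓ → ℚ} → (∀ j → f j ≡ g j) → ΣFin ℓ f ≡ ΣFin ℓ g
ΣFin-cong zero    f≗g = refl
ΣFin-cong (suc ℓ) f≗g = cong₂ _+_ (f≗g zero) (ΣFin-cong ℓ (f≗g ∘ suc))

ΣFin≡sum : ∀ ℓ (f : Fin ℓ → ℚ) → ΣFin ℓ f ≡ sum f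
ΣFin≡sum zero    f = refl
ΣFin≡sum (suc ℓ) f = cong (f zero +_) (ΣFin≡sum ℓ (f ∘ suc))

ΣFin-zero : ∀ ℓ → ΣFin ℓ (λ _ → 0ℚ) ≡ 0ℚ
ΣFin-zero ℓ = trans (ΣFin≡sum ℓ _) (sum-replicate-zero ℓ)

ΣFin-comm : ∀ ℓ m (F : Fin ℓ → Fin m → ℚ) →
  ΣFin ℓ (λ j → ΣFin m (F j)) ≡ ΣFin m (λ l → ΣFin ℓ (λ j → F j l))
ΣFin-comm ℓ m F = begin
  ΣFin ℓ (λ j → ΣFin m (F j))         ≡⟨ ΣFin-cong ℓ (λ j → ΣFin≡sum m (F j)) ⟩
  ΣFin ℓ (λ j → sum (F j))            ≡⟨ ΣFin≡sum ℓ _ ⟩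
  sum (λ j → sum (F j))               ≡⟨ ∑-comm F ⟩
  sum (λ l → sum (λ j → F j l))       ≡⟨ ΣFin≡sum m _ ⟨
  ΣFin m (λ l → sum (λ j → F j l))    ≡⟨ ΣFin-cong m (λ l → ΣFin≡sum ℓ _) ⟨
  ΣFin m (λ l → ΣFin ℓ (λ j → F j l)) ∎
  where open ≡-Reasoning

if-ΣFin : ∀ ℓ (b : Bool) (F : Fin ℓ → ℚ) →
  (if b then ΣFin ℓ F else 0ℚ) ≡ ΣFin ℓ (λ l → if b then F l else 0ℚ)
if-ΣFin ℓ true  F = refl
if-ΣFin ℓ false F = sym (ΣFin-zero ℓ)

ΣFin-point : ∀ m (x : Fin m) (a : Fin m → ℚ) →
  ΣFin m (λ j → if does (x ≟ j) then a j else 0ℚ) ≡ a x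
ΣFin-point (suc m) zero    a = trans (cong (a zero +_) (ΣFin-zero m)) (+-identityʳ (a zero))
ΣFin-point (suc m) (suc x) a = trans (+-identityˡ _) (ΣFin-point m x (a ∘ suc))

if-if-swap : ∀ (b c : Bool) (q : ℚ) →
  (if b then (if c then q else 0ℚ) else 0ℚ) ≡ (if c then (if b then q else 0ℚ) else 0ℚ)
if-if-swap true  true  q = refl
if-if-swap true  false q = refl
if-if-swap false true  q = refl
if-if-swap false false q = refl

≈M-sym : ∀ {ℓ d} {M N : Mat ℓ d} → M ≈M N → N ≈M M
≈M-sym M≈N i c = sym (M≈N i c)

≈M-trans : ∀ {ℓ d} {M N O : Mat ℓ d} → M ≈M N → N ≈M O → M ≈M O
≈M-trans M≈N N≈O i c = trans (M≈N i c) (N≈O i c)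

P-congʳ : ∀ {ℓ m d} (π : Fin ℓ → Fin m) {M N : Mat ℓ d} → M ≈M N → P π M ≈M P π N
P-congʳ {ℓ} π M≈N i c =
  ΣFin-cong ℓ (λ j → cong (λ q → if does (π j ≟ i) then q else 0ℚ) (M≈N j c))

P-congˡ : ∀ {ℓ m d} {σ τ : Fin ℓ → Fin m} (M : Mat ℓ d) → (∀ j → σ j ≡ τ j) → P σ M ≈M P τ M
P-congˡ {ℓ} M σ≗τ i c =
  ΣFin-cong ℓ (λ j → cong (λ x → if does (x ≟ i) then M j c else 0ℚ) (σ≗τ j))

P-∘ : ∀ {ℓ m o d} (σ : Fin m → Fin o) (τ : Fin ℓ → Fin m) (M : Mat ℓ d) →
  P σ (P τ M) ≈M P (σ ∘ τ) M
P-∘ {ℓ} {m} σ τ M i c = begin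
  ΣFin m (λ j → δ (σ j) (ΣFin ℓ (λ l → if does (τ l ≟ j) then M l c else 0ℚ)))
    ≡⟨ ΣFin-cong m (λ j → if-ΣFin ℓ (does (σ j ≟ i)) _) ⟩
  ΣFin m (λ j → ΣFin ℓ (λ l → δ (σ j) (if does (τ l ≟ j) then M l c else 0ℚ)))
    ≡⟨ ΣFin-comm m ℓ _ ⟩
  ΣFin ℓ (λ l → ΣFin m (λ j → δ (σ j) (if does (τ l ≟ j) then M l c else 0ℚ)))
    ≡⟨ ΣFin-cong ℓ (λ l → ΣFin-cong m (λ j → if-if-swap (does (σ j ≟ i)) _ (M l c))) ⟩
  ΣFin ℓ (λ l → ΣFin m (λ j → if does (τ l ≟ j) then δ (σ j) (M l c) else 0ℚ))
    ≡⟨ ΣFin-cong ℓ (λ l → ΣFin-point m (τ l) (λ j → δ (σ j) (M l c))) ⟩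
  ΣFin ℓ (λ l → δ (σ (τ l)) (M l c)) ∎
  where
  open ≡-Reasoning
  δ : Fin _ → ℚ → ℚ
  δ x q = if does (x ≟ i) then q else 0ℚ

P-square : ∀ {ℓ m m′ o d} (τ : Fin m → Fin o) (σ : Fin ℓ → Fin m)
  (τ′ : Fin m′ → Fin o) (σ′ : Fin ℓ → Fin m′) →
  (∀ j → τ (σ j) ≡ τ′ (σ′ j)) → (M : Mat ℓ d) → P τ (P σ M) ≈M P τ′ (P σ′ M)
P-square τ σ τ′ σ′ square M =
  ≈M-trans (P-∘ τ σ M) (≈M-trans (P-congˡ M square) (≈M-sym (P-∘ τ′ σ′ M)))

funToFin-cong : ∀ {k n} {x y : Fin k → Fin n} → (∀ t → x t ≡ y t) → funToFin x ≡ funToFin y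
funToFin-cong {zero}  x≗y = refl
funToFin-cong {suc k} x≗y = cong₂ combine (x≗y zero) (funToFin-cong (x≗y ∘ suc))

tupleMap : ∀ {n n′} k → (Fin n → Fin n′) → Fin (n ^ k) → Fin (n′ ^ k)
tupleMap {n} k f b = funToFin (f ∘ finToFun {n} {k} b)

tupleMap-funToFin : ∀ {n n′ k} (f : Fin n → Fin n′) (x : Fin k → Fin n) →
  tupleMap k f (funToFin x) ≡ funToFin (f ∘ x)
tupleMap-funToFin f x = funToFin-cong (cong f ∘ finToFun-funToFin x)

endpoint-map : ∀ {n n′} (f : Fin n → Fin n′) (i : Fin 2) (a : Fin n × Fin n) →
  endpoint i (f (proj₁ a) , f (proj₂ a)) ≡ f (endpoint i a)
endpoint-map f zero       a = refl
endpoint-map f (suc zero) a = refl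

reindex : ∀ {n k} → (Fin k → Fin k) → Fin (n ^ k) → Fin (n ^ k)
reindex {n} {k} i b = funToFin (finToFun {n} {k} b ∘ i)

tupleMap-reindex : ∀ {n n′ k} (f : Fin n → Fin n′) (i : Fin k → Fin k) b →
  tupleMap k f (reindex i b) ≡ reindex i (tupleMap k f b)
tupleMap-reindex {n} {k = k} f i b =
  trans (tupleMap-funToFin f (finToFun {n} {k} b ∘ i))
        (funToFin-cong (sym ∘ finToFun-funToFin (f ∘ finToFun {n} {k} b) ∘ i))

module _ {d} (𝓜 : LinearMinion d) (k : ℕ) {A B : Digraph} (hom : A ⟶ B) where

  private
    f : Fin (n A) → Fin (n B)
    f = proj₁ hom

    edgeMap : Fin (m A) → Fin (m B)
    edgeMap e = proj₁ (proj₂ hom e)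

  tupleMap-πₜ : ∀ i e → tupleMap k f (πₜ A k i e) ≡ πₜ B k i (edgeMap e)
  tupleMap-πₜ i e =
    trans (tupleMap-funToFin f (λ t → endpoint (i t) (edge A e)))
          (funToFin-cong λ t → trans (sym (endpoint-map f (i t) (edge A e)))
                                     (cong (endpoint (i t)) (sym (proj₂ (proj₂ hom e)))))

  FHyperedge-pushforward : ∀ {Ms} → FHyperedge 𝓜 A k Ms → FHyperedge 𝓜 B k (P (tupleMap k f) ∘ Ms)
  FHyperedge-pushforward (Q , Q∈𝓜 , Ms≈PQ) =
    P edgeMap Q , P-closed 𝓜 edgeMap Q Q∈𝓜 ,
    λ i → ≈M-trans (P-congʳ (tupleMap k f) (Ms≈PQ i))
                   (P-square (tupleMap k f) (πₜ A k i) (πₜ B k i) edgeMap (tupleMap-πₜ i) Q)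

  IsTensorial-pushforward : ∀ X {ξ} →
    IsTensorial 𝓜 k X A ξ → IsTensorial 𝓜 k X B (P (tupleMap k f) ∘ ξ)
  IsTensorial-pushforward X ((ξ∈𝓜 , ξ-edges) , ξ-tensorial) =
    ((λ x → P-closed 𝓜 (tupleMap k f) _ (ξ∈𝓜 x)) , (λ e → FHyperedge-pushforward (ξ-edges e))) ,
    λ x i → ≈M-trans (P-congʳ (tupleMap k f) (ξ-tensorial x i))
                     (P-square (tupleMap k f) (reindex i) (reindex i) (tupleMap k f)
                               (tupleMap-reindex f i) _)

proposition6p3 : ∀ {d : ℕ} (𝓜 : LinearMinion d) (k : ℕ) (X A B : Digraph) →
    A ⟶ B → HasTensorialHom 𝓜 k X A → HasTensorialHom 𝓜 k X B
proposition6p3 𝓜 k X A B hom (ξ , ξ-tensorial) =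
  P (tupleMap k (proj₁ hom)) ∘ ξ , IsTensorial-pushforward 𝓜 k {A} {B} hom X ξ-tensorial
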